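{- Let $S_1,S_2\subseteq\mathbb{Z}$ and let $f:S_1\times S_2\to\mathbb{Z}$ be order-preserving. Let $G_1,H_1$ be $S_1$-valued games and $G_2,H_2$ be $S_2$-valued games. Let $\Box$ be one of the relations $\gtrsim,\lesssim,\approx,\gtrsim_+,\gtrsim_-,\lesssim_+,\lesssim_-,\approx_+,\approx_-$. If $G_i\,\Box\,H_i$ for $i=1,2$, then $\tilde f(G_1,G_2)\,\Box\,\tilde f(H_1,H_2)$, where $\tilde f$ is the extension of $f$ to games.
   Context: A well-tempered scoring game is defined recursively: an even-tempered game is either an integer or a pair $\{G^L|G^R\}$ with finite nonempty sets of odd-tempered left and right options; an odd-tempered game is a pair $\{G^L|G^R\}$ with finite nonempty sets of even-tempered options. Integers have no options. $\pi(G)=0$ for even-tempered, $1$ for odd-tempered games. $G$ is $S$-valued if every integer subgame of $G$ (subgames being $G$ and subgames of its options) lies in $S$. Outcomes: $\operatorname{L}(n)=\operatorname{R}(n)=n$ for integers, otherwise $\operatorname{L}(G)=\max_{G^L}\operatorname{R}(G^L)$, $\operatorname{R}(G)=\min_{G^R}\operatorname{L}(G^R)$. Final outcomes: $\operatorname{Lf}(G)=\operatorname{L}(G)$, $\operatorname{Rf}(G)=\operatorname{R}(G)$ if $G$ is odd-tempered; $\operatorname{Lf}(G)=\operatorname{R}(G)$, $\operatorname{Rf}(G)=\operatorname{L}(G)$ if even-tempered. Disjunctive sum: integer sum if both are integers, else $G+H=\{G^L+H,G+H^L\mid G^R+H,G+H^R\}$. $G\gtrsim H$ iff $\operatorname{L}(G+X)\ge\operatorname{L}(H+X)$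 and $\operatorname{R}(G+X)\ge\operatorname{R}(H+X)$ for all games $X$; $G\gtrsim_+H$ iff $\pi(G)=\pi(H)$ and $\operatorname{Lf}(G+X)\ge\operatorname{Lf}(H+X)$ for all $X$; $G\gtrsim_-H$ iff $\pi(G)=\pi(H)$ and $\operatorname{Rf}(G+X)\ge\operatorname{Rf}(H+X)$ for all $X$; $\lesssim,\lesssim_\pm$ are the reverse relations and $\approx,\approx_\pm$ the corresponding equivalences (both directions). A function $f$ on tuples of integers is order-preserving if $f(x_1',\dots)\ge f(x_1,\dots)$ whenever $x_i'\ge x_i$ for all $i$. The extension of $f:S_1\times S_2\to\mathbb{Z}$ to games is $\tilde f(G_1,G_2)=f(G_1,G_2)$ if both are integers, and otherwise $\tilde f(G_1,G_2)=\{\tilde f(G_1^L,G_2),\tilde f(G_1,G_2^L)\mid\tilde f(G_1^R,G_2),\tilde f(G_1,G_2^R)\}$. -}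

module Defs where

open import Data.Bool using (Bool; true; false; not; if_then_else_)
open import Data.Nat using (ℕ; zero; suc)
open import Data.Fin using (Fin; zero; suc; splitAt)
open import Data.Sum using (_⊎_; inj₁; inj₂; [_,_]′)
open import Data.Product using (Σ; _×_; _,_)
open import Data.Integer using (ℤ; _≤_; _≥_; _⊔_; _⊓_)
import Data.Integer as ℤ
open import Relation.Binary.PropositionalEquality using (_≡_)

-- Raw game trees: an integer, or a pair of finite NONEMPTY families of
-- left/right options (indexed by Fin (suc m), Fin (suc n)).
data Game : Set where
  int  : ℤ → Game
  node : (m n : ℕ) → (Fin (suc m) → Game) → (Fin (suc n) → Game) → Game

-- Parity as Bool: false = even-tempered, true = odd-tempered.
data Tempered : Bool → Game → Set where
  t-int  : ∀ {k} → Tempered false (int k)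
  t-node : ∀ {p m n l r} →
           (∀ i → Tempered (not p) (l i)) →
           (∀ j → Tempered (not p) (r j)) →
           Tempered p (node m n l r)

WT : Game → Set
WT G = Σ Bool (λ p → Tempered p G)

-- π(G): parity (true = odd). On well-tempered games this is the unique p with Tempered p G.
π : Game → Bool
π (int _)          = false
π (node _ _ l _)   = not (π (l zero))

data Valued (S : ℤ → Set) : Game → Set where
  v-int  : ∀ {k} → S k → Valued S (int k)
  v-node : ∀ {m n l r} →
           (∀ i → Valued S (l i)) →
           (∀ j → Valued S (r j)) →
           Valued S (node m n l r)

maxF : (m : ℕ) → (Fin (suc m) → ℤ) → ℤ
maxF zero    h = h zero
maxF (suc m) h = h zero ⊔ maxF m (λ i → h (suc i))

minF : (m : ℕ) → (Fin (suc m) → ℤ) → ℤ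
minF zero    h = h zero
minF (suc m) h = h zero ⊓ minF m (λ i → h (suc i))

Lo Ro : Game → ℤ
Lo (int k)        = k
Lo (node m n l r) = maxF m (λ i → Ro (l i))
Ro (int k)        = k
Ro (node m n l r) = minF n (λ j → Lo (r j))

Lf Rf : Game → ℤ
Lf G = if π G then Lo G else Ro G
Rf G = if π G then Ro G else Lo G

join : ∀ {A : Set} {a b : ℕ} → (Fin (suc a) → A) → (Fin (suc b) → A) →
       Fin (suc (a Data.Nat.+ suc b)) → A
join {a = a} f g k = [ f , g ]′ (splitAt (suc a) k)

infixl 6 _⊕_
_⊕_ : Game → Game → Game
int a ⊕ int b = int (a ℤ.+ b)
int a ⊕ node m n l r = node m n (λ i → int a ⊕ l i) (λ j → int a ⊕ r j)
node m n l r ⊕ int b = node m n (λ i → l i ⊕ int b) (λ j → r j ⊕ int b)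
node m n l r ⊕ node m' n' l' r' =
  node (m Data.Nat.+ suc m') (n Data.Nat.+ suc n')
    (join (λ i → l i ⊕ node m' n' l' r') (λ i → node m n l r ⊕ l' i))
    (join (λ j → r j ⊕ node m' n' l' r') (λ j → node m n l r ⊕ r' j))

_≳_ : Game → Game → Set
G ≳ H = ∀ X → WT X → (Lo (G ⊕ X) ≥ Lo (H ⊕ X)) × (Ro (G ⊕ X) ≥ Ro (H ⊕ X))

_≳₊_ : Game → Game → Set
G ≳₊ H = (π G ≡ π H) × (∀ X → WT X → Lf (G ⊕ X) ≥ Lf (H ⊕ X))

_≳₋_ : Game → Game → Set
G ≳₋ H = (π G ≡ π H) × (∀ X → WT X → Rf (G ⊕ X) ≥ Rf (H ⊕ X))

data Rel : Set where
  gtr lss eqv gtr₊ gtr₋ lss₊ lss₋ eqv₊ eqv₋ : Rel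

⟦_⟧ : Rel → Game → Game → Set
⟦ gtr  ⟧ G H = G ≳ H
⟦ lss  ⟧ G H = H ≳ G
⟦ eqv  ⟧ G H = (G ≳ H) × (H ≳ G)
⟦ gtr₊ ⟧ G H = G ≳₊ H
⟦ gtr₋ ⟧ G H = G ≳₋ H
⟦ lss₊ ⟧ G H = H ≳₊ G
⟦ lss₋ ⟧ G H = H ≳₋ G
⟦ eqv₊ ⟧ G H = (G ≳₊ H) × (H ≳₊ G)
⟦ eqv₋ ⟧ G H = (G ≳₋ H) × (H ≳₋ G)

Fun : (S₁ S₂ : ℤ → Set) → Set
Fun S₁ S₂ = (x : ℤ) → S₁ x → (y : ℤ) → S₂ y → ℤ

OrderPreserving : ∀ {S₁ S₂} → Fun S₁ S₂ → Set
OrderPreserving {S₁} {S₂} f =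
  ∀ x x' (sx : S₁ x) (sx' : S₁ x') y y' (sy : S₂ y) (sy' : S₂ y') →
  x ≤ x' → y ≤ y' → f x sx y sy ≤ f x' sx' y' sy'

ext : ∀ {S₁ S₂} → Fun S₁ S₂ →
      (G₁ : Game) → Valued S₁ G₁ → (G₂ : Game) → Valued S₂ G₂ → Game
ext f (int a) (v-int sa) (int b) (v-int sb) = int (f a sa b sb)
ext f (int a) (v-int sa) (node m n l r) (v-node vl vr) =
  node m n (λ i → ext f (int a) (v-int sa) (l i) (vl i))
           (λ j → ext f (int a) (v-int sa) (r j) (vr j))
ext f (node m n l r) (v-node vl vr) (int b) (v-int sb) =
  node m n (λ i → ext f (l i) (vl i) (int b) (v-int sb))
           (λ j → ext f (r j) (vr j) (int b) (v-int sb))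
ext f (node m n l r) (v-node vl vr) (node m' n' l' r') (v-node vl' vr') =
  node (m Data.Nat.+ suc m') (n Data.Nat.+ suc n')
    (join (λ i → ext f (l i) (vl i) (node m' n' l' r') (v-node vl' vr'))
          (λ i → ext f (node m n l r) (v-node vl vr) (l' i) (vl' i)))
    (join (λ j → ext f (r j) (vr j) (node m' n' l' r') (v-node vl' vr'))
          (λ j → ext f (node m n l r) (v-node vl vr) (r' j) (vr' j)))

-- To get f̃(G,K) ≥ f̃(H,K) in an outcome o from G ≥ H, fix a test game X and let n be
-- o(f̃(H,K) + X).  For each leaf b of K and c of X, monotonicity of f makes
-- {a : n ≤ f(a,b) + c} an up-set, so on the finitely many leaves of G and H it is cut out by
-- a threshold t(b,c).  Take the test game Y = Ũ(K,X) with U(b,c) = −t(b,c).  The positions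
-- (A,B,C) ↦ f̃(A,B) + C and (A,B,C) ↦ A + Ũ(B,C) have the same options, so f̃(H,K) + X and
-- H + Y are the same tree, and every leaf reaching n in the first reaches 0 in the second;
-- dually, leaves of G + Y reaching 0 give leaves of f̃(G,K) + X reaching n.  Hence
-- 0 ≤ o(H + Y) ≤ o(G + Y) forces n ≤ o(f̃(G,K) + X).  Swapping the coordinates gives
-- monotonicity in the second argument, and the nine relations are conjunctions of such
-- outcome comparisons, plus a parity condition preserved since π(f̃(G₁,G₂)) = π G₁ xor π G₂.

module Submission where

open import Defs
open import Data.Bool using (true; false; not; _xor_)
open import Data.Bool.Properties using (not-injective; not-involutive; not-distribˡ-xor; not-distribʳ-xor)
open import Data.Empty using (⊥-elim)
open import Data.Fin using (Fin; zero; suc; splitAt; _↑ˡ_; _↑ʳ_)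
open import Data.Integer using (ℤ; 0ℤ; 1ℤ; _≤_; _<_; _⊓_; _⊔_; _+_; -_; _≤?_)
import Data.Integer as ℤ
open import Data.Integer.Properties
open import Data.Nat using (zero; suc)
open import Data.Product using (∃-syntax; _×_; _,_; proj₁; proj₂)
open import Data.Sum using (_⊎_; inj₁; inj₂)
import Data.Sum as Sum
open import Data.Unit using (⊤; tt)
open import Data.Vec.Functional.Properties using (lookup-++ˡ; lookup-++ʳ)
open import Data.Vec.Functional.Relation.Unary.All.Properties using (++⁺)
open import Function using (_∘_; id)
open import Induction.WellFounded using (Acc; acc; WellFounded)
open import Relation.Nullary using (yes; no; Dec)
open import Relation.Binary.PropositionalEquality
  using (_≡_; refl; sym; trans; cong; cong₂; subst; subst₂; module ≡-Reasoning)

maxF-upper : ∀ m (h : Fin (suc m) → ℤ) i → h i ≤ maxF m h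
maxF-upper zero    h zero    = ≤-refl
maxF-upper (suc m) h zero    = i≤i⊔j _ _
maxF-upper (suc m) h (suc i) = i≤j⇒i≤k⊔j (h zero) (maxF-upper m (h ∘ suc) i)

≤-maxF-witness : ∀ m (h : Fin (suc m) → ℤ) {k} → k ≤ maxF m h → ∃[ i ] k ≤ h i
≤-maxF-witness zero    h k≤ = zero , k≤
≤-maxF-witness (suc m) h k≤ with ⊔-sel (h zero) (maxF m (h ∘ suc))
... | inj₁ eq = zero , subst (_ ≤_) eq k≤
... | inj₂ eq with ≤-maxF-witness m (h ∘ suc) (subst (_ ≤_) eq k≤)
...   | i , k≤hi = suc i , k≤hi

minF-lower : ∀ m (h : Fin (suc m) → ℤ) i → minF m h ≤ h i
minF-lower zero    h zero    = ≤-refl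
minF-lower (suc m) h zero    = i⊓j≤i _ _
minF-lower (suc m) h (suc i) = i≤j⇒k⊓i≤j (h zero) (minF-lower m (h ∘ suc) i)

minF-greatest : ∀ m (h : Fin (suc m) → ℤ) {k} → (∀ i → k ≤ h i) → k ≤ minF m h
minF-greatest zero    h k≤ = k≤ zero
minF-greatest (suc m) h k≤ = ⊓-glb (k≤ zero) (minF-greatest m (h ∘ suc) (k≤ ∘ suc))

⊓-≤-witness : ∀ x y {k} → x ⊓ y ≤ k → x ≤ k ⊎ y ≤ k
⊓-≤-witness x y ≤k = Sum.map (λ eq → subst (_≤ _) eq ≤k) (λ eq → subst (_≤ _) eq ≤k) (⊓-sel x y)

minF-≤-witness : ∀ m (h : Fin (suc m) → ℤ) {k} → minF m h ≤ k → ∃[ i ] h i ≤ k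
minF-≤-witness zero    h ≤k = zero , ≤k
minF-≤-witness (suc m) h ≤k with ⊓-≤-witness (h zero) (minF m (h ∘ suc)) ≤k
... | inj₁ h0≤k = zero , h0≤k
... | inj₂ min≤k with minF-≤-witness m (h ∘ suc) min≤k
...   | i , hi≤k = suc i , hi≤k

-- join f g is definitionally Data.Vec.Functional's f ++ g.
join-split : ∀ {A : Set} {a b} (f : Fin (suc a) → A) (g : Fin (suc b) → A) k →
             (∃[ i ] join f g k ≡ f i) ⊎ (∃[ j ] join f g k ≡ g j)
join-split {a = a} f g k with splitAt (suc a) k
... | inj₁ i = inj₁ (i , refl)
... | inj₂ j = inj₂ (j , refl)

data Side : Set where
  Left Right : Side

data Opt : Side → Game → Game → Set where
  left  : ∀ {m n l r} i → Opt Left  (node m n l r) (l i)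
  right : ∀ {m n l r} j → Opt Right (node m n l r) (r j)

data IsNode : Game → Set where
  isNode : ∀ {m n l r} → IsNode (node m n l r)

_⊏_ : Game → Game → Set
A' ⊏ A = ∃[ s ] Opt s A A'

⊏-wellFounded : WellFounded _⊏_
⊏-wellFounded (int _)        = acc λ { (_ , ()) }
⊏-wellFounded (node m n l r) = acc λ { (_ , left i)  → ⊏-wellFounded (l i)
                                     ; (_ , right j) → ⊏-wellFounded (r j) }

⊕-options : ∀ {s} A B {Z} → Opt s (A ⊕ B) Z →
            (∃[ A' ] Opt s A A' × Z ≡ A' ⊕ B) ⊎ (∃[ B' ] Opt s B B' × Z ≡ A ⊕ B')
⊕-options (int _)        (node _ _ _ _) (left j)  = inj₂ (_ , left j , refl)
⊕-options (int _)        (node _ _ _ _) (right j) = inj₂ (_ , right j , refl)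
⊕-options (node _ _ _ _) (int _)        (left i)  = inj₁ (_ , left i , refl)
⊕-options (node _ _ _ _) (int _)        (right i) = inj₁ (_ , right i , refl)
⊕-options A@(node _ _ l r) B@(node _ _ l' r') (left k) =
  Sum.map (λ (i , eq) → _ , left i , eq) (λ (j , eq) → _ , left j , eq)
          (join-split (λ i → l i ⊕ B) (λ j → A ⊕ l' j) k)
⊕-options A@(node _ _ l r) B@(node _ _ l' r') (right k) =
  Sum.map (λ (i , eq) → _ , right i , eq) (λ (j , eq) → _ , right j , eq)
          (join-split (λ i → r i ⊕ B) (λ j → A ⊕ r' j) k)

⊕-optionˡ : ∀ {s A A'} B → Opt s A A' → Opt s (A ⊕ B) (A' ⊕ B)
⊕-optionˡ (int _) (left i)  = left i
⊕-optionˡ (int _) (right j) = right j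
⊕-optionˡ {A = A@(node _ _ l r)} B@(node _ _ l' r') (left i) =
  subst (Opt _ _) (lookup-++ˡ (λ i → l i ⊕ B) (λ j → A ⊕ l' j) i) (left (i ↑ˡ _))
⊕-optionˡ {A = A@(node _ _ l r)} B@(node _ _ l' r') (right i) =
  subst (Opt _ _) (lookup-++ˡ (λ i → r i ⊕ B) (λ j → A ⊕ r' j) i) (right (i ↑ˡ _))

⊕-optionʳ : ∀ {s B B'} A → Opt s B B' → Opt s (A ⊕ B) (A ⊕ B')
⊕-optionʳ (int _) (left j)  = left j
⊕-optionʳ (int _) (right j) = right j
⊕-optionʳ {B = B@(node _ _ l' r')} A@(node m n l r) (left j) =
  subst (Opt _ _) (lookup-++ʳ (λ i → l i ⊕ B) (λ j → A ⊕ l' j) j) (left (suc m ↑ʳ j))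
⊕-optionʳ {B = B@(node _ _ l' r')} A@(node m n l r) (right j) =
  subst (Opt _ _) (lookup-++ʳ (λ i → r i ⊕ B) (λ j → A ⊕ r' j) j) (right (suc n ↑ʳ j))

⊕-isNode : ∀ {A B} → IsNode A ⊎ IsNode B → IsNode (A ⊕ B)
⊕-isNode {node _ _ _ _} {int _}        _ = isNode
⊕-isNode {node _ _ _ _} {node _ _ _ _} _ = isNode
⊕-isNode {int _}        {node _ _ _ _} _ = isNode
⊕-isNode {int _}        {int _}        (inj₁ ())
⊕-isNode {int _}        {int _}        (inj₂ ())

VGame : (ℤ → Set) → Set
VGame P = ∃[ A ] Valued P A

data VOpt {P : ℤ → Set} : Side → VGame P → VGame P → Set where
  left  : ∀ {m n l r vl vr} i → VOpt Left  (node m n l r , v-node vl vr) (l i , vl i)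
  right : ∀ {m n l r vl vr} j → VOpt Right (node m n l r , v-node vl vr) (r j , vr j)

VOpt⇒Opt : ∀ {P s} {x x' : VGame P} → VOpt s x x' → Opt s (proj₁ x) (proj₁ x')
VOpt⇒Opt (left i)  = left i
VOpt⇒Opt (right j) = right j

Opt⇒VOpt : ∀ {P s A A'} → Opt s A A' → (vA : Valued P A) → ∃[ vA' ] VOpt s (A , vA) (A' , vA')
Opt⇒VOpt (left i)  (v-node vl vr) = vl i , left i
Opt⇒VOpt (right j) (v-node vl vr) = vr j , right j

VOpt-valued : ∀ {P R s} {x x' : VGame P} → VOpt s x x' → Valued R (proj₁ x) → Valued R (proj₁ x')
VOpt-valued (left i)  (v-node wl wr) = wl i
VOpt-valued (right j) (v-node wl wr) = wr j

Valued-map : ∀ {P R : ℤ → Set} → (∀ {a} → P a → R a) → ∀ {A} → Valued P A → Valued R A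
Valued-map f (v-int pa)     = v-int (f pa)
Valued-map f (v-node vl vr) = v-node (Valued-map f ∘ vl) (Valued-map f ∘ vr)

Valued-int : ∀ {P a} → Valued P (int a) → P a
Valued-int (v-int pa) = pa

⊤-valued : ∀ A → Valued (λ _ → ⊤) A
⊤-valued (int _)        = v-int tt
⊤-valued (node _ _ l r) = v-node (⊤-valued ∘ l) (⊤-valued ∘ r)

module _ {P₁ P₂ : ℤ → Set} (F : Fun P₁ P₂) where

  extᵛ : VGame P₁ → VGame P₂ → Game
  extᵛ (A , vA) (B , vB) = ext F A vA B vB

  ext-options : ∀ {s} x y {Z} → Opt s (extᵛ x y) Z →
                (∃[ x' ] VOpt s x x' × Z ≡ extᵛ x' y) ⊎ (∃[ y' ] VOpt s y y' × Z ≡ extᵛ x y')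
  ext-options (int _ , v-int _) (node _ _ _ _ , v-node _ _) (left j)  = inj₂ (_ , left j , refl)
  ext-options (int _ , v-int _) (node _ _ _ _ , v-node _ _) (right j) = inj₂ (_ , right j , refl)
  ext-options (node _ _ _ _ , v-node _ _) (int _ , v-int _) (left i)  = inj₁ (_ , left i , refl)
  ext-options (node _ _ _ _ , v-node _ _) (int _ , v-int _) (right i) = inj₁ (_ , right i , refl)
  ext-options x@(node _ _ _ _ , v-node vl vr) y@(node _ _ _ _ , v-node vl' vr') (left k) =
    Sum.map (λ (i , eq) → _ , left i , eq) (λ (j , eq) → _ , left j , eq)
            (join-split (λ i → extᵛ (_ , vl i) y) (λ j → extᵛ x (_ , vl' j)) k)
  ext-options x@(node _ _ _ _ , v-node vl vr) y@(node _ _ _ _ , v-node vl' vr') (right k) =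
    Sum.map (λ (i , eq) → _ , right i , eq) (λ (j , eq) → _ , right j , eq)
            (join-split (λ i → extᵛ (_ , vr i) y) (λ j → extᵛ x (_ , vr' j)) k)

  ext-optionˡ : ∀ {s x x'} y → VOpt s x x' → Opt s (extᵛ x y) (extᵛ x' y)
  ext-optionˡ (int _ , v-int _) (left i)  = left i
  ext-optionˡ (int _ , v-int _) (right i) = right i
  ext-optionˡ {x = x@(_ , v-node vl vr)} y@(node _ _ _ _ , v-node vl' vr') (left i) =
    subst (Opt _ _) (lookup-++ˡ (λ i → extᵛ (_ , vl i) y) (λ j → extᵛ x (_ , vl' j)) i) (left (i ↑ˡ _))
  ext-optionˡ {x = x@(_ , v-node vl vr)} y@(node _ _ _ _ , v-node vl' vr') (right i) =
    subst (Opt _ _) (lookup-++ˡ (λ i → extᵛ (_ , vr i) y) (λ j → extᵛ x (_ , vr' j)) i) (right (i ↑ˡ _))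

  ext-optionʳ : ∀ {s y y'} x → VOpt s y y' → Opt s (extᵛ x y) (extᵛ x y')
  ext-optionʳ (int _ , v-int _) (left j)  = left j
  ext-optionʳ (int _ , v-int _) (right j) = right j
  ext-optionʳ {y = y@(_ , v-node vl' vr')} x@(node m n _ _ , v-node vl vr) (left j) =
    subst (Opt _ _) (lookup-++ʳ (λ i → extᵛ (_ , vl i) y) (λ j → extᵛ x (_ , vl' j)) j) (left (suc m ↑ʳ j))
  ext-optionʳ {y = y@(_ , v-node vl' vr')} x@(node m n _ _ , v-node vl vr) (right j) =
    subst (Opt _ _) (lookup-++ʳ (λ i → extᵛ (_ , vr i) y) (λ j → extᵛ x (_ , vr' j)) j) (right (suc n ↑ʳ j))

  ext-isNode : ∀ {x y} → IsNode (proj₁ x) ⊎ IsNode (proj₁ y) → IsNode (extᵛ x y)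
  ext-isNode {node _ _ _ _ , v-node _ _} {int _ , v-int _}          _ = isNode
  ext-isNode {node _ _ _ _ , v-node _ _} {node _ _ _ _ , v-node _ _} _ = isNode
  ext-isNode {int _ , v-int _}          {node _ _ _ _ , v-node _ _} _ = isNode
  ext-isNode {int _ , v-int _}          {int _ , v-int _}          (inj₁ ())
  ext-isNode {int _ , v-int _}          {int _ , v-int _}          (inj₂ ())

tempered-π : ∀ {p G} → Tempered p G → π G ≡ p
tempered-π t-int             = refl
tempered-π {p} (t-node tl _) = trans (cong not (tempered-π (tl zero))) (not-involutive p)

not-xorˡ : ∀ p q {G} → Tempered (not p xor q) G → Tempered (not (p xor q)) G
not-xorˡ p q = subst (λ b → Tempered b _) (sym (not-distribˡ-xor p q))

not-xorʳ : ∀ p q {G} → Tempered (p xor not q) G → Tempered (not (p xor q)) G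
not-xorʳ p q = subst (λ b → Tempered b _) (sym (not-distribʳ-xor p q))

⊕-tempered : ∀ {p q A B} → Tempered p A → Tempered q B → Tempered (p xor q) (A ⊕ B)
⊕-tempered t-int t-int          = t-int
⊕-tempered t-int (t-node tl tr) = t-node (⊕-tempered t-int ∘ tl) (⊕-tempered t-int ∘ tr)
⊕-tempered {p} (t-node tl tr) t-int =
  t-node (λ i → not-xorˡ p false (⊕-tempered (tl i) t-int))
         (λ j → not-xorˡ p false (⊕-tempered (tr j) t-int))
⊕-tempered {p} {q} tA@(t-node tl tr) tB@(t-node tl' tr') =
  t-node (++⁺ (Tempered _) (λ i → not-xorˡ p q (⊕-tempered (tl i) tB))
                           (λ j → not-xorʳ p q (⊕-tempered tA (tl' j))))
         (++⁺ (Tempered _) (λ i → not-xorˡ p q (⊕-tempered (tr i) tB))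
                           (λ j → not-xorʳ p q (⊕-tempered tA (tr' j))))

ext-tempered : ∀ {P₁ P₂} (F : Fun P₁ P₂) {p q A B} (vA : Valued P₁ A) (vB : Valued P₂ B) →
               Tempered p A → Tempered q B → Tempered (p xor q) (ext F A vA B vB)
ext-tempered F (v-int _) (v-int _) t-int t-int = t-int
ext-tempered F vA@(v-int _) (v-node vl vr) t-int (t-node tl tr) =
  t-node (λ i → ext-tempered F vA (vl i) t-int (tl i)) (λ j → ext-tempered F vA (vr j) t-int (tr j))
ext-tempered F {p} (v-node vl vr) vB@(v-int _) (t-node tl tr) t-int =
  t-node (λ i → not-xorˡ p false (ext-tempered F (vl i) vB (tl i) t-int))
         (λ j → not-xorˡ p false (ext-tempered F (vr j) vB (tr j) t-int))
ext-tempered F {p} {q} vA@(v-node vl vr) vB@(v-node vl' vr') tA@(t-node tl tr) tB@(t-node tl' tr') =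
  t-node (++⁺ (Tempered _) (λ i → not-xorˡ p q (ext-tempered F (vl i) vB (tl i) tB))
                           (λ j → not-xorʳ p q (ext-tempered F vA (vl' j) tA (tl' j))))
         (++⁺ (Tempered _) (λ i → not-xorˡ p q (ext-tempered F (vr i) vB (tr i) tB))
                           (λ j → not-xorʳ p q (ext-tempered F vA (vr' j) tA (tr' j))))

⊕-WT : ∀ {A B} → WT A → WT B → WT (A ⊕ B)
⊕-WT (p , tA) (q , tB) = p xor q , ⊕-tempered tA tB

ext-WT : ∀ {P₁ P₂} (F : Fun P₁ P₂) {A B} (vA : Valued P₁ A) (vB : Valued P₂ B) →
         WT A → WT B → WT (ext F A vA B vB)
ext-WT F vA vB (p , tA) (q , tB) = p xor q , ext-tempered F vA vB tA tB

-- Outcomes and bisimilar game trees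

data Outcome : Set where
  lo ro lf rf : Outcome

outcome : Outcome → Game → ℤ
outcome lo = Lo
outcome ro = Ro
outcome lf = Lf
outcome rf = Rf

_≥[_]_ : Game → Outcome → Game → Set
G ≥[ o ] H = ∀ X → WT X → outcome o (H ⊕ X) ≤ outcome o (G ⊕ X)

data Bisim (m k : ℤ) : Game → Game → Set where
  leaf   : ∀ {a b} → (m ≤ a → k ≤ b) → Bisim m k (int a) (int b)
  branch : ∀ {G G'} → IsNode G → IsNode G' →
           (∀ {s Z}  → Opt s G Z   → ∃[ Z' ] Opt s G' Z' × Bisim m k Z Z') →
           (∀ {s Z'} → Opt s G' Z' → ∃[ Z ]  Opt s G Z   × Bisim m k Z Z') →
           Bisim m k G G'

module _ {m k : ℤ} where

  Bisim-Lo : ∀ {G G'} → Bisim m k G G' → m ≤ Lo G → k ≤ Lo G'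
  Bisim-Ro : ∀ {G G'} → Bisim m k G G' → m ≤ Ro G → k ≤ Ro G'

  Bisim-Lo (leaf m⇒k) = m⇒k
  Bisim-Lo (branch (isNode {a} {l = l}) (isNode {a'} {l = l'}) forth _) m≤Lo
    with ≤-maxF-witness a (Ro ∘ l) m≤Lo
  ... | i , m≤Ro with forth (left i)
  ...   | _ , left i' , bisim = ≤-trans (Bisim-Ro bisim m≤Ro) (maxF-upper a' (Ro ∘ l') i')

  Bisim-Ro (leaf m⇒k) = m⇒k
  Bisim-Ro (branch (isNode {n = b} {r = r}) (isNode {n = b'} {r = r'}) _ back) m≤Ro =
    minF-greatest b' (Lo ∘ r') answer
    where
    answer : ∀ j' → k ≤ Lo (r' j')
    answer j' with back (right j')
    ... | _ , right j , bisim = Bisim-Lo bisim (≤-trans m≤Ro (minF-lower b (Lo ∘ r) j))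

  Bisim-π : ∀ {G G'} → Bisim m k G G' → WT G → WT G' → π G ≡ π G'
  Bisim-π bisim (_ , tG) (_ , tG') =
    trans (tempered-π tG) (trans (parity bisim tG tG') (sym (tempered-π tG')))
    where
    parity : ∀ {p q G G'} → Bisim m k G G' → Tempered p G → Tempered q G' → p ≡ q
    parity (leaf _) t-int t-int = refl
    parity (branch _ _ forth _) (t-node tl _) (t-node tl' _) with forth (left zero)
    ... | _ , left i' , bisim = not-injective (parity bisim (tl zero) (tl' i'))

  Bisim-outcome : ∀ o {G G'} → Bisim m k G G' → WT G → WT G' → m ≤ outcome o G → k ≤ outcome o G'
  Bisim-outcome lo bisim _ _ = Bisim-Lo bisim
  Bisim-outcome ro bisim _ _ = Bisim-Ro bisim
  Bisim-outcome lf {G} {G'} bisim wG wG' with π G | π G' | Bisim-π bisim wG wG'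
  ... | true  | _ | refl = Bisim-Lo bisim
  ... | false | _ | refl = Bisim-Ro bisim
  Bisim-outcome rf {G} {G'} bisim wG wG' with π G | π G' | Bisim-π bisim wG wG'
  ... | true  | _ | refl = Bisim-Ro bisim
  ... | false | _ | refl = Bisim-Lo bisim

-- Sum-like combinations of three valued games

module _ {P₁ P₂ P₃ : ℤ → Set} where

  Triple : Set
  Triple = VGame P₁ × VGame P₂ × VGame P₃

  data Move (s : Side) : Triple → Triple → Set where
    move₁ : ∀ {x x' y z} → VOpt s x x' → Move s (x , y , z) (x' , y , z)
    move₂ : ∀ {x y y' z} → VOpt s y y' → Move s (x , y , z) (x , y' , z)
    move₃ : ∀ {x y z z'} → VOpt s z z' → Move s (x , y , z) (x , y , z')

  leafTriple : ∀ {a b c} → P₁ a → P₂ b → P₃ c → Triple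
  leafTriple pa pb pc = (int _ , v-int pa) , (int _ , v-int pb) , (int _ , v-int pc)

  HasNode : Triple → Set
  HasNode ((A , _) , (B , _) , (C , _)) = IsNode A ⊎ IsNode B ⊎ IsNode C

  data TripleView : Triple → Set where
    leaf   : ∀ {a b c} (pa : P₁ a) (pb : P₂ b) (pc : P₃ c) → TripleView (leafTriple pa pb pc)
    branch : ∀ {t} → HasNode t → TripleView t

  tripleView : ∀ t → TripleView t
  tripleView ((int _ , v-int pa) , (int _ , v-int pb) , (int _ , v-int pc)) = leaf pa pb pc
  tripleView ((node _ _ _ _ , _) , _ , _)                      = branch (inj₁ isNode)
  tripleView ((int _ , _) , (node _ _ _ _ , _) , _)            = branch (inj₂ (inj₁ isNode))
  tripleView ((int _ , _) , (int _ , _) , (node _ _ _ _ , _))  = branch (inj₂ (inj₂ isNode))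

  -- Combinations such as f̃(A,B) + C and A + Ũ(B,C), whose options are exactly the moves
  -- in a single coordinate.
  record SumLike : Set where
    field
      game        : Triple → Game
      score       : ∀ {a b c} → P₁ a → P₂ b → P₃ c → ℤ
      game-leaf   : ∀ {a b c} (pa : P₁ a) (pb : P₂ b) (pc : P₃ c) →
                    game (leafTriple pa pb pc) ≡ int (score pa pb pc)
      game-branch : ∀ {t} → HasNode t → IsNode (game t)
      options     : ∀ {s t Z} → Opt s (game t) Z → ∃[ t' ] Move s t t' × Z ≡ game t'
      option      : ∀ {s t t'} → Move s t t' → Opt s (game t) (game t')
      game-WT     : ∀ {A B C} (vA : Valued P₁ A) (vB : Valued P₂ B) (vC : Valued P₃ C) →
                    WT A → WT B → WT C → WT (game ((A , vA) , (B , vB) , (C , vC)))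

  module _ (Φ Ψ : SumLike) {m k : ℤ} (Inv : Triple → Set)
    (Inv-move : ∀ {s t t'} → Move s t t' → Inv t → Inv t')
    (Inv-leaf : ∀ {a b c} (pa : P₁ a) (pb : P₂ b) (pc : P₃ c) → Inv (leafTriple pa pb pc) →
                m ≤ SumLike.score Φ pa pb pc → k ≤ SumLike.score Ψ pa pb pc) where

    private
      module Φ = SumLike Φ
      module Ψ = SumLike Ψ

    SumLike-bisim : ∀ {x y z} → Acc _⊏_ (proj₁ x) → Acc _⊏_ (proj₁ y) → Acc _⊏_ (proj₁ z) →
                    Inv (x , y , z) → Bisim m k (Φ.game (x , y , z)) (Ψ.game (x , y , z))
    SumLike-bisim {x} {y} {z} (acc ⊏x) (acc ⊏y) (acc ⊏z) inv with tripleView (x , y , z)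
    ... | leaf pa pb pc =
      subst₂ (Bisim m k) (sym (Φ.game-leaf pa pb pc)) (sym (Ψ.game-leaf pa pb pc))
             (leaf (Inv-leaf pa pb pc inv))
    ... | branch nodes = branch (Φ.game-branch nodes) (Ψ.game-branch nodes) forth back
      where
      after : ∀ {s t'} → Move s (x , y , z) t' → Bisim m k (Φ.game t') (Ψ.game t')
      after mv@(move₁ o) = SumLike-bisim (⊏x (_ , VOpt⇒Opt o)) (acc ⊏y) (acc ⊏z) (Inv-move mv inv)
      after mv@(move₂ o) = SumLike-bisim (acc ⊏x) (⊏y (_ , VOpt⇒Opt o)) (acc ⊏z) (Inv-move mv inv)
      after mv@(move₃ o) = SumLike-bisim (acc ⊏x) (acc ⊏y) (⊏z (_ , VOpt⇒Opt o)) (Inv-move mv inv)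

      forth : ∀ {s Z} → Opt s (Φ.game (x , y , z)) Z → ∃[ Z' ] Opt s (Ψ.game (x , y , z)) Z' × Bisim m k Z Z'
      forth o with Φ.options o
      ... | t' , mv , refl = Ψ.game t' , Ψ.option mv , after mv

      back : ∀ {s Z'} → Opt s (Ψ.game (x , y , z)) Z' → ∃[ Z ] Opt s (Φ.game (x , y , z)) Z × Bisim m k Z Z'
      back o with Ψ.options o
      ... | t' , mv , refl = Φ.game t' , Φ.option mv , after mv

module _ {P₁ P₂ P₃ : ℤ → Set} where

  ext⊕ : Fun P₁ P₂ → Triple {P₁} {P₂} {P₃} → Game
  ext⊕ F (x , y , (C , _)) = extᵛ F x y ⊕ C

  ⊕ext : Fun P₂ P₃ → Triple {P₁} {P₂} {P₃} → Game
  ⊕ext U ((A , _) , y , z) = A ⊕ extᵛ U y z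

  ext⊕-sumLike : Fun P₁ P₂ → SumLike {P₁} {P₂} {P₃}
  ext⊕-sumLike F = record
    { game        = ext⊕ F
    ; score       = λ {a b c} pa pb _ → F a pa b pb + c
    ; game-leaf   = λ _ _ _ → refl
    ; game-branch = λ { (inj₁ n) → ⊕-isNode (inj₁ (ext-isNode F (inj₁ n)))
                      ; (inj₂ (inj₁ n)) → ⊕-isNode (inj₁ (ext-isNode F (inj₂ n)))
                      ; (inj₂ (inj₂ n)) → ⊕-isNode (inj₂ n) }
    ; options     = options
    ; option      = λ { (move₁ o) → ⊕-optionˡ _ (ext-optionˡ F _ o)
                      ; (move₂ o) → ⊕-optionˡ _ (ext-optionʳ F _ o)
                      ; (move₃ o) → ⊕-optionʳ _ (VOpt⇒Opt o) }
    ; game-WT     = λ vA vB _ wA wB wC → ⊕-WT (ext-WT F vA vB wA wB) wC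
    }
    where
    options : ∀ {s t Z} → Opt s (ext⊕ F t) Z → ∃[ t' ] Move s t t' × Z ≡ ext⊕ F t'
    options {t = x , y , (C , vC)} o with ⊕-options (extᵛ F x y) C o
    ... | inj₂ (C' , oC , refl) =
      let vC' , vo = Opt⇒VOpt oC vC in (x , y , (C' , vC')) , move₃ vo , refl
    ... | inj₁ (_ , oE , refl) with ext-options F x y oE
    ...   | inj₁ (x' , vo , refl) = (x' , y , (C , vC)) , move₁ vo , refl
    ...   | inj₂ (y' , vo , refl) = (x , y' , (C , vC)) , move₂ vo , refl

  ⊕ext-sumLike : Fun P₂ P₃ → SumLike {P₁} {P₂} {P₃}
  ⊕ext-sumLike U = record
    { game        = ⊕ext U
    ; score       = λ {a b c} _ pb pc → a + U b pb c pc
    ; game-leaf   = λ _ _ _ → refl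
    ; game-branch = λ { (inj₁ n) → ⊕-isNode (inj₁ n)
                      ; (inj₂ (inj₁ n)) → ⊕-isNode (inj₂ (ext-isNode U (inj₁ n)))
                      ; (inj₂ (inj₂ n)) → ⊕-isNode (inj₂ (ext-isNode U (inj₂ n))) }
    ; options     = options
    ; option      = λ { (move₁ o) → ⊕-optionˡ _ (VOpt⇒Opt o)
                      ; (move₂ o) → ⊕-optionʳ _ (ext-optionˡ U _ o)
                      ; (move₃ o) → ⊕-optionʳ _ (ext-optionʳ U _ o) }
    ; game-WT     = λ _ vB vC wA wB wC → ⊕-WT wA (ext-WT U vB vC wB wC)
    }
    where
    options : ∀ {s t Z} → Opt s (⊕ext U t) Z → ∃[ t' ] Move s t t' × Z ≡ ⊕ext U t'
    options {t = (A , vA) , y , z} o with ⊕-options A (extᵛ U y z) o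
    ... | inj₁ (A' , oA , refl) =
      let vA' , vo = Opt⇒VOpt oA vA in ((A' , vA') , y , z) , move₁ vo , refl
    ... | inj₂ (_ , oE , refl) with ext-options U y z oE
    ...   | inj₁ (y' , vo , refl) = ((A , vA) , y' , z) , move₂ vo , refl
    ...   | inj₂ (z' , vo , refl) = ((A , vA) , y , z') , move₃ vo , refl

Move-valued₁ : ∀ {P₁ P₂ P₃ R s} {t t' : Triple {P₁} {P₂} {P₃}} → Move s t t' →
               Valued R (proj₁ (proj₁ t)) → Valued R (proj₁ (proj₁ t'))
Move-valued₁ (move₁ o) = VOpt-valued o
Move-valued₁ (move₂ _) = id
Move-valued₁ (move₃ _) = id

swap₁₂ : ∀ {P₁ P₂ P₃} → Triple {P₁} {P₂} {P₃} → Triple {P₂} {P₁} {P₃}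
swap₁₂ (x , y , z) = y , x , z

Move-swap₁₂ : ∀ {P₁ P₂ P₃ s} {t t' : Triple {P₁} {P₂} {P₃}} →
              Move s t t' → Move s (swap₁₂ t) (swap₁₂ t')
Move-swap₁₂ (move₁ o) = move₂ o
Move-swap₁₂ (move₂ o) = move₁ o
Move-swap₁₂ (move₃ o) = move₃ o

swap-sumLike : ∀ {P₁ P₂ P₃} → SumLike {P₁} {P₂} {P₃} → SumLike {P₂} {P₁} {P₃}
swap-sumLike Φ = record
  { game        = game ∘ swap₁₂
  ; score       = λ pb pa pc → score pa pb pc
  ; game-leaf   = λ pb pa pc → game-leaf pa pb pc
  ; game-branch = λ { (inj₁ n) → game-branch (inj₂ (inj₁ n))
                    ; (inj₂ (inj₁ n)) → game-branch (inj₁ n)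
                    ; (inj₂ (inj₂ n)) → game-branch (inj₂ (inj₂ n)) }
  ; options     = λ o → let t' , mv , eq = options o in swap₁₂ t' , Move-swap₁₂ mv , eq
  ; option      = option ∘ Move-swap₁₂
  ; game-WT     = λ vB vA vC wB wA wC → game-WT vA vB vC wA wB wC
  }
  where open SumLike Φ

-- Thresholds

maxLeaf : Game → ℤ
maxLeaf (int a)        = a
maxLeaf (node m n l r) = maxF m (maxLeaf ∘ l) ⊔ maxF n (maxLeaf ∘ r)

leaves-≤ : ∀ A {k} → maxLeaf A ≤ k → Valued (_≤ k) A
leaves-≤ (int a)        ≤k = v-int ≤k
leaves-≤ (node m n l r) ≤k =
  v-node (λ i → leaves-≤ (l i) (≤-trans (maxF-upper m (maxLeaf ∘ l) i) (i⊔j≤k⇒i≤k _ _ ≤k)))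
         (λ j → leaves-≤ (r j) (≤-trans (maxF-upper n (maxLeaf ∘ r) j) (i⊔j≤k⇒j≤k _ _ ≤k)))

module Threshold {S : ℤ → Set} (Up : (a : ℤ) → S a → Set) (Up? : ∀ a sa → Dec (Up a sa))
  (Up-mono : ∀ {a a'} (sa : S a) (sa' : S a') → a ≤ a' → Up a sa → Up a' sa')
  {G H : Game} (vG : Valued S G) (vH : Valued S H) where

  cap : ℤ
  cap = ℤ.suc (maxLeaf G)

  -- Leaves outside Up count as cap, which exceeds every leaf of G, so that G-above is vacuous
  -- when no leaf is in Up.
  least : ∀ {A} → Valued S A → ℤ
  least (v-int {a} sa) with Up? a sa
  ... | yes _ = a
  ... | no  _ = cap
  least (v-node {m} {n} vl vr) = minF m (λ i → least (vl i)) ⊓ minF n (λ j → least (vr j))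

  least-below : ∀ {A} (vA : Valued S A) {t} → t ≤ least vA → Valued (λ a → ∀ sa → Up a sa → t ≤ a) A
  least-below (v-int {a} sa₀) t≤ with Up? a sa₀
  ... | yes _  = v-int λ _ _ → t≤
  ... | no ¬up = v-int λ sa up → ⊥-elim (¬up (Up-mono sa sa₀ ≤-refl up))
  least-below (v-node {m} {n} vl vr) t≤ =
    v-node (λ i → least-below (vl i) (≤-trans t≤ (i≤j⇒i⊓k≤j _ (minF-lower m (λ i → least (vl i)) i))))
           (λ j → least-below (vr j) (≤-trans t≤ (i≤j⇒k⊓i≤j _ (minF-lower n (λ j → least (vr j)) j))))

  least-above : ∀ {A} (vA : Valued S A) {a} (sa : S a) → least vA ≤ a → a < cap → Up a sa
  least-above (v-int {a₀} sa₀) sa ≤a a<cap with Up? a₀ sa₀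
  ... | yes up = Up-mono sa₀ sa ≤a up
  ... | no _   = ⊥-elim (<⇒≱ a<cap ≤a)
  least-above (v-node {m} {n} vl vr) sa ≤a a<cap with ⊓-≤-witness _ _ ≤a
  ... | inj₁ ≤a' = let i , ≤a'' = minF-≤-witness m _ ≤a' in least-above (vl i) sa ≤a'' a<cap
  ... | inj₂ ≤a' = let j , ≤a'' = minF-≤-witness n _ ≤a' in least-above (vr j) sa ≤a'' a<cap

  threshold : ℤ
  threshold = least vG ⊓ least vH

  H-below : Valued (λ a → ∀ sa → Up a sa → threshold ≤ a) H
  H-below = least-below vH (i⊓j≤j _ _)

  G-above : Valued (λ a → ∀ sa → threshold ≤ a → Up a sa) G
  G-above = Valued-map above (leaves-≤ G ≤-refl)
    where
    above : ∀ {a} → a ≤ maxLeaf G → ∀ sa → threshold ≤ a → Up a sa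
    above a≤max sa t≤a = Sum.[ (λ ≤a → least-above vG sa ≤a a<cap) , (λ ≤a → least-above vH sa ≤a a<cap) ]
                               (⊓-≤-witness _ _ t≤a)
      where
      a<cap : _ < cap
      a<cap = suc[i]≤j⇒i<j (+-monoʳ-≤ 1ℤ a≤max)

module _ {P₁ P₂ : ℤ → Set} (Φ : SumLike {P₁} {P₂} {λ _ → ⊤}) where
  open SumLike Φ

  scoreAt : ∀ {a b} → P₁ a → P₂ b → ℤ → ℤ
  scoreAt pa pb c = score {c = c} pa pb tt

  SumLike-monotone :
    (∀ {a a' b} (pa : P₁ a) (pa' : P₁ a') (pb : P₂ b) c → a ≤ a' → scoreAt pa pb c ≤ scoreAt pa' pb c) →
    ∀ o {G H K X} (vG : Valued P₁ G) (vH : Valued P₁ H) (vK : Valued P₂ K) →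
    WT G → WT H → WT K → WT X → G ≥[ o ] H →
    outcome o (game ((H , vH) , (K , vK) , (X , ⊤-valued X))) ≤
    outcome o (game ((G , vG) , (K , vK) , (X , ⊤-valued X)))
  SumLike-monotone score-mono o {G} {H} {K} {X} vG vH vK wG wH wK wX G≥H =
    Bisim-outcome o bisimG (Ψ.game-WT vG vK vX wG wK wX) (game-WT vG vK vX wG wK wX) 0≤G+Y
    where
    vX : Valued (λ _ → ⊤) X
    vX = ⊤-valued X

    n : ℤ
    n = outcome o (game ((H , vH) , (K , vK) , (X , vX)))

    module T {b} (pb : P₂ b) (c : ℤ) =
      Threshold (λ a pa → n ≤ scoreAt pa pb c) (λ a pa → n ≤? scoreAt pa pb c)
                (λ pa pa' a≤a' n≤ → ≤-trans n≤ (score-mono pa pa' pb c a≤a')) vG vH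

    U : Fun P₂ (λ _ → ⊤)
    U b pb c _ = - T.threshold pb c

    Y : Game
    Y = ext U K vK X vX

    Ψ : SumLike
    Ψ = ⊕ext-sumLike U
    module Ψ = SumLike Ψ

    InvH : Triple → Set
    InvH ((A , _) , _) =
      ∀ {b} (pb : P₂ b) c → Valued (λ a → ∀ pa → n ≤ scoreAt pa pb c → T.threshold pb c ≤ a) A

    InvG : Triple → Set
    InvG ((A , _) , _) =
      ∀ {b} (pb : P₂ b) c → Valued (λ a → ∀ pa → T.threshold pb c ≤ a → n ≤ scoreAt pa pb c) A

    bisimH : Bisim n 0ℤ (game ((H , vH) , (K , vK) , (X , vX))) (H ⊕ Y)
    bisimH = SumLike-bisim Φ Ψ InvH (λ mv inv pb c → Move-valued₁ mv (inv pb c))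
               (λ {c = c} pa pb _ inv n≤ → i≤j⇒0≤j-i (Valued-int (inv pb c) pa n≤))
               (⊏-wellFounded H) (⊏-wellFounded K) (⊏-wellFounded X) T.H-below

    bisimG : Bisim 0ℤ n (G ⊕ Y) (game ((G , vG) , (K , vK) , (X , vX)))
    bisimG = SumLike-bisim Ψ Φ InvG (λ mv inv pb c → Move-valued₁ mv (inv pb c))
               (λ {c = c} pa pb _ inv 0≤ → Valued-int (inv pb c) pa (0≤i-j⇒j≤i 0≤))
               (⊏-wellFounded G) (⊏-wellFounded K) (⊏-wellFounded X) T.G-above

    0≤H+Y : 0ℤ ≤ outcome o (H ⊕ Y)
    0≤H+Y = Bisim-outcome o bisimH (game-WT vH vK vX wH wK wX) (Ψ.game-WT vH vK vX wH wK wX) ≤-refl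

    0≤G+Y : 0ℤ ≤ outcome o (G ⊕ Y)
    0≤G+Y = ≤-trans 0≤H+Y (G≥H Y (ext-WT U vK vX wK wX))

ext-π : ∀ {S₁ S₂} (f : Fun S₁ S₂) {G₁ G₂} (vG₁ : Valued S₁ G₁) (vG₂ : Valued S₂ G₂) →
        WT G₁ → WT G₂ → π (ext f G₁ vG₁ G₂ vG₂) ≡ π G₁ xor π G₂
ext-π f vG₁ vG₂ (p , t₁) (q , t₂)
  rewrite tempered-π t₁ | tempered-π t₂ = tempered-π (ext-tempered f vG₁ vG₂ t₁ t₂)

ExtPreserves : ∀ {S₁ S₂} → Fun S₁ S₂ → (Game → Game → Set) → Set
ExtPreserves {S₁} {S₂} f R = ∀ {G₁ H₁ G₂ H₂} → WT G₁ → WT H₁ → WT G₂ → WT H₂ →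
  (vG₁ : Valued S₁ G₁) (vH₁ : Valued S₁ H₁) (vG₂ : Valued S₂ G₂) (vH₂ : Valued S₂ H₂) →
  R G₁ H₁ → R G₂ H₂ → R (ext f G₁ vG₁ G₂ vG₂) (ext f H₁ vH₁ H₂ vH₂)

module _ {S₁ S₂ : ℤ → Set} {f : Fun S₁ S₂} (f-mono : OrderPreserving f) {G₁ H₁ G₂ H₂ : Game}
  (wG₁ : WT G₁) (wH₁ : WT H₁) (wG₂ : WT G₂) (wH₂ : WT H₂)
  (vG₁ : Valued S₁ G₁) (vH₁ : Valued S₁ H₁) (vG₂ : Valued S₂ G₂) (vH₂ : Valued S₂ H₂) where

  private
    G H : Game
    G = ext f G₁ vG₁ G₂ vG₂
    H = ext f H₁ vH₁ H₂ vH₂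

  ext-monotone : ∀ o → G₁ ≥[ o ] H₁ → G₂ ≥[ o ] H₂ → G ≥[ o ] H
  ext-monotone o G₁≥H₁ G₂≥H₂ X wX = ≤-trans
    (SumLike-monotone (swap-sumLike (ext⊕-sumLike f)) mono₂ o vG₂ vH₂ vH₁ wG₂ wH₂ wH₁ wX G₂≥H₂)
    (SumLike-monotone (ext⊕-sumLike f) mono₁ o vG₁ vH₁ vG₂ wG₁ wH₁ wG₂ wX G₁≥H₁)
    where
    mono₁ : ∀ {a a' b} (sa : S₁ a) (sa' : S₁ a') (sb : S₂ b) c → a ≤ a' → f a sa b sb + c ≤ f a' sa' b sb + c
    mono₁ sa sa' sb c a≤a' = +-monoˡ-≤ c (f-mono _ _ sa sa' _ _ sb sb a≤a' ≤-refl)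

    mono₂ : ∀ {b b' a} (sb : S₂ b) (sb' : S₂ b') (sa : S₁ a) c → b ≤ b' → f a sa b sb + c ≤ f a sa b' sb' + c
    mono₂ sb sb' sa c b≤b' = +-monoˡ-≤ c (f-mono _ _ sa sa _ _ sb sb' ≤-refl b≤b')

  ext-π-cong : π G₁ ≡ π H₁ → π G₂ ≡ π H₂ → π G ≡ π H
  ext-π-cong π₁ π₂ = begin
    π G           ≡⟨ ext-π f vG₁ vG₂ wG₁ wG₂ ⟩
    π G₁ xor π G₂ ≡⟨ cong₂ _xor_ π₁ π₂ ⟩
    π H₁ xor π H₂ ≡⟨ ext-π f vH₁ vH₂ wH₁ wH₂ ⟨
    π H           ∎
    where open ≡-Reasoning

  ext-≳ : G₁ ≳ H₁ → G₂ ≳ H₂ → G ≳ H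
  ext-≳ h₁ h₂ X wX = ext-monotone lo (λ X → proj₁ ∘ h₁ X) (λ X → proj₁ ∘ h₂ X) X wX
                   , ext-monotone ro (λ X → proj₂ ∘ h₁ X) (λ X → proj₂ ∘ h₂ X) X wX

  ext-≳₊ : G₁ ≳₊ H₁ → G₂ ≳₊ H₂ → G ≳₊ H
  ext-≳₊ (π₁ , h₁) (π₂ , h₂) = ext-π-cong π₁ π₂ , ext-monotone lf h₁ h₂

  ext-≳₋ : G₁ ≳₋ H₁ → G₂ ≳₋ H₂ → G ≳₋ H
  ext-≳₋ (π₁ , h₁) (π₂ , h₂) = ext-π-cong π₁ π₂ , ext-monotone rf h₁ h₂

mainTheorem9 : (S₁ S₂ : ℤ → Set) (f : Fun S₁ S₂) → OrderPreserving f →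
    (G₁ H₁ G₂ H₂ : Game) →
    WT G₁ → WT H₁ → WT G₂ → WT H₂ →
    (vG₁ : Valued S₁ G₁) (vH₁ : Valued S₁ H₁) (vG₂ : Valued S₂ G₂) (vH₂ : Valued S₂ H₂) →
    (□ : Rel) → ⟦ □ ⟧ G₁ H₁ → ⟦ □ ⟧ G₂ H₂ →
    ⟦ □ ⟧ (ext f G₁ vG₁ G₂ vG₂) (ext f H₁ vH₁ H₂ vH₂)
mainTheorem9 S₁ S₂ f f-mono G₁ H₁ G₂ H₂ wG₁ wH₁ wG₂ wH₂ vG₁ vH₁ vG₂ vH₂ = preserves
  where
  G = ext f G₁ vG₁ G₂ vG₂
  H = ext f H₁ vH₁ H₂ vH₂

  forward : ∀ {R} → ExtPreserves f R → R G₁ H₁ → R G₂ H₂ → R G H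
  forward p = p wG₁ wH₁ wG₂ wH₂ vG₁ vH₁ vG₂ vH₂

  backward : ∀ {R} → ExtPreserves f R → R H₁ G₁ → R H₂ G₂ → R H G
  backward p = p wH₁ wG₁ wH₂ wG₂ vH₁ vG₁ vH₂ vG₂

  both : ∀ {R} → ExtPreserves f R → R G₁ H₁ × R H₁ G₁ → R G₂ H₂ × R H₂ G₂ → R G H × R H G
  both p (h₁ , k₁) (h₂ , k₂) = forward p h₁ h₂ , backward p k₁ k₂

  preserves : ∀ □ → ⟦ □ ⟧ G₁ H₁ → ⟦ □ ⟧ G₂ H₂ → ⟦ □ ⟧ G H
  preserves gtr  = forward  (ext-≳ f-mono)
  preserves lss  = backward (ext-≳ f-mono)
  preserves eqv  = both     (ext-≳ f-mono)
  preserves gtr₊ = forward  (ext-≳₊ f-mono)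
  preserves gtr₋ = forward  (ext-≳₋ f-mono)
  preserves lss₊ = backward (ext-≳₊ f-mono)
  preserves lss₋ = backward (ext-≳₋ f-mono)
  preserves eqv₊ = both     (ext-≳₊ f-mono)
  preserves eqv₋ = both     (ext-≳₋ f-mono)
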